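{- Let $T$ be a standard set-valued shifted tableau with labels $1,\ldots,r$ and let $\sigma=x_{s_1}x_{s_2}\cdots x_{s_r}$ be a monomial agreeing with $\mathcal D(T)$. Then $T(\sigma)$ is a weak set-valued shifted tableau.
   Context: Shifted shape of a strict partition $\lambda$: boxes $(i,j)$, $i\le j\le i+\lambda_i-1$; boxes $(i,i)$ form the main diagonal. Ordered alphabet $1'<1<2'<2<\cdots$. A set-valued (resp. weak set-valued) shifted tableau fills each box with a finite nonempty set (resp. multiset) of letters so that: (1) the smallest entry of a box is $\ge$ the largest entry of the box directly left; (2) the smallest entry of a box is $\ge$ the largest entry of the box directly above; (3) no primed entries on the main diagonal; (4) each unprimed integer appears in at most one box per column; (5) each primed integer appears in at most one box per row. It is standard if its labels are exactly $1,\ldots,r$ for some $r$, each appearing exactly once, either primed or unprimed. Descent set of a standard set-valued shifted tableau $T$: $i\in\mathcal D(T)$ iff (a) both $i$ and $(i+1)'$ appear; or (b) $i$ and $i+1$ both appear unprimed with the box of $i$ in a row strictly above the box of $i+1$; or (c) $i'$ and $(i+1)'$ both appear, in different boxes, with the box of $i'$ weakly below the box of $(i+1)'$. A monomial $x_{s_1}\cdots x_{s_r}$ agrees with $\mathcal D\subseteq[r-1]$ if $s_i\le s_{i+1}$ for all $i$, with strict inequality when $i\in\mathcal D$. $T(\sigma)$ is obtained from $T$ by replacing each label $i$ by $s_i$ and each label $i'$ by $s_i'$. -}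

module Defs where

open import Data.Nat using (ℕ; zero; suc; _+_; _≤_; _<_; _>_)
open import Data.Bool using (Bool; true; false)
open import Data.Fin using (Fin; toℕ)
open import Data.List using (List; []; map; length; lookup)
open import Data.List.Relation.Unary.All using (All)
open import Data.List.Relation.Unary.Linked using (Linked)
open import Data.List.Relation.Unary.Unique.Propositional using (Unique)
open import Data.List.Membership.Propositional using (_∈_)
open import Data.Product using (Σ; _×_; ∃; ∃-syntax)
open import Data.Sum using (_⊎_)
open import Relation.Binary.PropositionalEquality using (_≡_; _≢_)
open import Relation.Nullary using (¬_)

-- Letters of the alphabet 1' < 1 < 2' < 2 < ⋯ :
-- 'mk n true' is the primed letter n', 'mk n false' is the unprimed letter n.
record Letter : Set where
  constructor mk
  field
    num    : ℕ
    primed : Bool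
open Letter public

-- rank encodes the total order 1' < 1 < 2' < 2 < ⋯  (n' ↦ 2n, n ↦ 2n+1)
rank : Letter → ℕ
rank (mk n true)  = n + n
rank (mk n false) = suc (n + n)

_≼_ : Letter → Letter → Set
a ≼ b = rank a ≤ rank b

IsStrictPartition : List ℕ → Set
IsStrictPartition λs = All (λ k → 0 < k) λs × Linked _>_ λs

-- boxes (i,j) (1-indexed) of the shifted shape: i ≤ j ≤ i + λ_i - 1
InShape : List ℕ → ℕ → ℕ → Set
InShape λs i j = Σ (Fin (length λs)) λ k → (i ≡ suc (toℕ k)) × (i ≤ j) × (j < i + lookup λs k)

-- a filling assigns to each box (i,j) a finite list of letters
-- (read as a multiset; for set-valued tableaux it is duplicate-free)
Filling : Set
Filling = ℕ → ℕ → List Letter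

record IsWeakSetValued (λs : List ℕ) (T : Filling) : Set where
  field
    outside  : ∀ i j → ¬ InShape λs i j → T i j ≡ []
    nonempty : ∀ i j → InShape λs i j → T i j ≢ []
    positive : ∀ i j ℓ → ℓ ∈ T i j → 1 ≤ num ℓ
    rowWeak  : ∀ i j a b → a ∈ T i j → b ∈ T i (suc j) → a ≼ b
    colWeak  : ∀ i j a b → a ∈ T i j → b ∈ T (suc i) j → a ≼ b
    diag     : ∀ i ℓ → ℓ ∈ T i i → primed ℓ ≡ false
    colUnp   : ∀ n i i' j → mk n false ∈ T i j → mk n false ∈ T i' j → i ≡ i'
    rowPr    : ∀ n i j j' → mk n true ∈ T i j → mk n true ∈ T i j' → j ≡ j'

record IsSetValued (λs : List ℕ) (T : Filling) : Set where
  field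
    weak  : IsWeakSetValued λs T
    isSet : ∀ i j → Unique (T i j)

record IsStandard (r : ℕ) (λs : List ℕ) (T : Filling) : Set where
  field
    setValued : IsSetValued λs T
    bounded   : ∀ i j ℓ → ℓ ∈ T i j → num ℓ ≤ r
    occurs    : ∀ n → 1 ≤ n → n ≤ r → ∃[ i ] ∃[ j ] ∃[ p ] (mk n p ∈ T i j)
    once      : ∀ n i j p i' j' p' → mk n p ∈ T i j → mk n p' ∈ T i' j' →
                (i ≡ i') × (j ≡ j') × (p ≡ p')

data Descent (T : Filling) (i : ℕ) : Set where
  descA : ∀ a b c d → mk i false ∈ T a b → mk (suc i) true ∈ T c d → Descent T i
  descB : ∀ a b c d → mk i false ∈ T a b → mk (suc i) false ∈ T c d → a < c → Descent T i
  descC : ∀ a b c d → mk i true ∈ T a b → mk (suc i) true ∈ T c d →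
          ¬ ((a ≡ c) × (b ≡ d)) → c ≤ a → Descent T i

-- the monomial x_{s 1} ⋯ x_{s r} (variables indexed by positive integers)
-- agrees with 𝒟(T)
record Agrees (r : ℕ) (T : Filling) (s : ℕ → ℕ) : Set where
  field
    posVar : ∀ i → 1 ≤ i → i ≤ r → 1 ≤ s i
    weakly : ∀ i → 1 ≤ i → i < r → s i ≤ s (suc i)
    strict : ∀ i → 1 ≤ i → i < r → Descent T i → s i < s (suc i)

relabel : (ℕ → ℕ) → Filling → Filling
relabel s T i j = map (λ ℓ → mk (s (num ℓ)) (primed ℓ)) (T i j)

-- If s is constant on the labels n < n+1 < ⋯ < m, then none of n, …, m-1 is a descent of T.
-- Walking through such a run label by label, the absence of descents of types (a), (b), (c)
-- says: once a label is unprimed all later ones are; unprimed labels climb weakly upwards;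
-- primed labels move weakly downwards and can only stay in a row by staying in the same box.
-- Hence relabelling by s keeps rows and columns weakly increasing (a smaller label never
-- becomes a larger letter), two equal unprimed letters of T(σ) cannot share a column (the
-- later label would sit weakly above the earlier one, against column increase in T), and two
-- equal primed letters of T(σ) cannot share a row.
module Submission where

open import Defs
open import Data.Nat using (ℕ; suc; _+_; _≤_; _<_; _>_; _≤′_; ≤′-refl; ≤′-step; ⌊_/2⌋; z≤n; s≤s)
open import Data.Nat.Properties
open import Data.Bool using (true; false)
open import Data.Fin using (Fin; toℕ) renaming (zero to fzero; suc to fsuc)
open import Data.Fin.Properties using (any?)
open import Data.List using (List; []; _∷_; map; length; lookup)
open import Data.List.Relation.Unary.Linked using (Linked; head; tail)
open import Data.List.Relation.Unary.Any using (here)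
open import Data.List.Membership.Propositional using (_∈_)
open import Data.List.Membership.Propositional.Properties using (∈-map⁻; ∉[])
open import Data.Product using (_×_; _,_; proj₁; proj₂; ∃-syntax)
open import Data.Sum using (inj₁; inj₂)
open import Relation.Binary.PropositionalEquality
open import Relation.Nullary using (¬_; Dec; yes; no; contradiction)
open import Relation.Nullary.Decidable using (decidable-stable; _×-dec_)

∈-of-≢[] : ∀ {A : Set} (xs : List A) → xs ≢ [] → ∃[ x ] x ∈ xs
∈-of-≢[] []       xs≢[] = contradiction refl xs≢[]
∈-of-≢[] (x ∷ xs) _     = x , here refl

map-≢[] : ∀ {A B : Set} {f : A → B} {xs : List A} → xs ≢ [] → map f xs ≢ []
map-≢[] {xs = []}    xs≢[] _ = xs≢[] refl
map-≢[] {xs = _ ∷ _} _     ()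

≼-trans : ∀ {x y z} → x ≼ y → y ≼ z → x ≼ z
≼-trans = ≤-trans

num≡⌊rank/2⌋ : ∀ ℓ → num ℓ ≡ ⌊ rank ℓ /2⌋
num≡⌊rank/2⌋ (mk n true)  = n≡⌊n+n/2⌋ n
num≡⌊rank/2⌋ (mk n false) = n≡⌈n+n/2⌉ n

≼⇒num≤ : ∀ {x y} → x ≼ y → num x ≤ num y
≼⇒num≤ {x} {y} x≼y =
  subst₂ _≤_ (sym (num≡⌊rank/2⌋ x)) (sym (num≡⌊rank/2⌋ y)) (⌊n/2⌋-mono x≼y)

rank≤1+2num : ∀ ℓ → rank ℓ ≤ suc (num ℓ + num ℓ)
rank≤1+2num (mk n true)  = n≤1+n (n + n)
rank≤1+2num (mk n false) = ≤-refl

2num≤rank : ∀ ℓ → num ℓ + num ℓ ≤ rank ℓ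
2num≤rank (mk n true)  = ≤-refl
2num≤rank (mk n false) = n≤1+n (n + n)

num<⇒≼ : ∀ {x y} → num x < num y → x ≼ y
num<⇒≼ {x} {y} x<y =
  ≤-trans (rank≤1+2num x) (≤-trans (+-mono-≤ x<y (<⇒≤ x<y)) (2num≤rank y))

≼-same-num : ∀ {n p q} → (p ≡ false → q ≡ false) → mk n p ≼ mk n q
≼-same-num {n} {true}  {true}  _ = ≤-refl
≼-same-num {n} {true}  {false} _ = n≤1+n (n + n)
≼-same-num {n} {false} {true}  h with () ← h refl
≼-same-num {n} {false} {false} _ = ≤-refl

lookup-pred> : ∀ {xs m} → Linked _>_ xs → (k : Fin (length xs)) → toℕ k ≡ suc m →
               ∃[ k′ ] toℕ k′ ≡ m × lookup xs k < lookup xs k′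
lookup-pred> {x ∷ y ∷ ys} L (fsuc fzero) refl = fzero , refl , head L
lookup-pred> {x ∷ y ∷ ys} L (fsuc (fsuc k)) refl with lookup-pred> (tail L) (fsuc k) refl
... | k′ , k′≡k , lt = fsuc k′ , cong suc k′≡k , lt

InShape-rowUp : ∀ {λs i j} → IsStrictPartition λs → 0 < i →
                InShape λs (suc i) j → InShape λs i j
InShape-rowUp {λs} {suc m} (_ , L) _ (k , i≡1+k , i≤j , j<)
  with lookup-pred> L k (suc-injective (sym i≡1+k))
... | k′ , k′≡m , lt =
  k′ , cong suc (sym k′≡m) , ≤-trans (n≤1+n _) i≤j ,
  ≤-trans j< (s≤s (≤-trans (≤-reflexive (sym (+-suc m (lookup λs k)))) (+-monoʳ-≤ m lt)))

inShape? : ∀ λs i j → Dec (InShape λs i j)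
inShape? λs i j = any? λ k → (i ≟ suc (toℕ k)) ×-dec (i ≤? j) ×-dec (j <? i + lookup λs k)

module _ {λs : List ℕ} {T : Filling} (W : IsWeakSetValued λs T) where
  open IsWeakSetValued W

  ∈⇒InShape : ∀ {i j ℓ} → ℓ ∈ T i j → InShape λs i j
  ∈⇒InShape {i} {j} {ℓ} ℓ∈ =
    decidable-stable (inShape? λs i j) λ ∉shape → ∉[] (subst (ℓ ∈_) (outside i j ∉shape) ℓ∈)

  column-≼ : IsStrictPartition λs → ∀ {i i′ j x y} → i < i′ → x ∈ T i j → y ∈ T i′ j → x ≼ y
  column-≼ SP {i} {suc i′} {j} {x} {y} i<1+i′ x∈ y∈ with m<1+n⇒m<n∨m≡n i<1+i′
  ... | inj₂ refl = colWeak i j x y x∈ y∈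
  ... | inj₁ i<i′ with ∈-of-≢[] (T i′ j) (nonempty i′ j above)
    where above = InShape-rowUp SP (≤-trans (s≤s z≤n) i<i′) (∈⇒InShape y∈)
  ...   | z , z∈ = ≼-trans {x} {z} {y} (column-≼ SP i<i′ x∈ z∈) (colWeak i′ j z y z∈ y∈)

mono-on : ∀ {s : ℕ → ℕ} {lo hi} → (∀ i → lo ≤ i → i < hi → s i ≤ s (suc i)) →
          ∀ {n m} → lo ≤ n → n ≤′ m → m ≤ hi → s n ≤ s m
mono-on step lo≤n ≤′-refl _ = ≤-refl
mono-on step lo≤n (≤′-step {m} n≤′m) m<hi =
  ≤-trans (mono-on step lo≤n n≤′m (<⇒≤ m<hi)) (step m (≤-trans lo≤n (≤′⇒≤ n≤′m)) m<hi)

module Runs {r : ℕ} {λs : List ℕ} {T : Filling} (ST : IsStandard r λs T) where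
  open IsStandard ST
  open IsWeakSetValued (IsSetValued.weak setValued)

  NoDescentIn : ℕ → ℕ → Set
  NoDescentIn n m = ∀ i → n ≤ i → i < m → ¬ Descent T i

  NoDescentIn-init : ∀ {n m} → NoDescentIn n (suc m) → NoDescentIn n m
  NoDescentIn-init nd i n≤i i<m = nd i n≤i (m<n⇒m<1+n i<m)

  NoDescentIn-last : ∀ {n m} → n ≤′ m → NoDescentIn n (suc m) → ¬ Descent T m
  NoDescentIn-last n≤′m nd = nd _ (≤′⇒≤ n≤′m) ≤-refl

  occurs-before : ∀ {n m p q a b c e} → mk n p ∈ T a b → n ≤′ m → mk (suc m) q ∈ T c e →
                  ∃[ a′ ] ∃[ b′ ] ∃[ p′ ] mk m p′ ∈ T a′ b′
  occurs-before n∈ n≤′m m+1∈ =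
    occurs _ (≤-trans (positive _ _ _ n∈) (≤′⇒≤ n≤′m)) (<⇒≤ (bounded _ _ _ m+1∈))

  unprimed-run : ∀ {n m p a b c e} → n ≤′ m → NoDescentIn n m →
                 mk n false ∈ T a b → mk m p ∈ T c e → p ≡ false
  unprimed-run ≤′-refl _ n∈ m∈ = sym (proj₂ (proj₂ (once _ _ _ _ _ _ _ n∈ m∈)))
  unprimed-run {p = false} (≤′-step _) _ _ _ = refl
  unprimed-run {p = true} (≤′-step n≤′m) nd n∈ m+1∈ with occurs-before n∈ n≤′m m+1∈
  ... | a′ , b′ , p′ , m∈ with unprimed-run n≤′m (NoDescentIn-init nd) n∈ m∈
  ...   | refl = contradiction (descA _ _ _ _ m∈ m+1∈) (NoDescentIn-last n≤′m nd)

  unprimed-run-rows : ∀ {n m a b c e} → n ≤′ m → NoDescentIn n m →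
                      mk n false ∈ T a b → mk m false ∈ T c e → c ≤ a
  unprimed-run-rows ≤′-refl _ n∈ m∈ = ≤-reflexive (sym (proj₁ (once _ _ _ _ _ _ _ n∈ m∈)))
  unprimed-run-rows {c = c} (≤′-step n≤′m) nd n∈ m+1∈ with occurs-before n∈ n≤′m m+1∈
  ... | a′ , b′ , p′ , m∈ with unprimed-run n≤′m (NoDescentIn-init nd) n∈ m∈
  ...   | refl = ≤-trans c≤a′ (unprimed-run-rows n≤′m (NoDescentIn-init nd) n∈ m∈)
    where
    c≤a′ : c ≤ a′
    c≤a′ = ≮⇒≥ λ a′<c → NoDescentIn-last n≤′m nd (descB _ _ _ _ m∈ m+1∈ a′<c)

  primed-run-rows : ∀ {n m a b c e} → n ≤′ m → NoDescentIn n m →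
                    mk n true ∈ T a b → mk m true ∈ T c e → a ≤ c × (a ≡ c → b ≡ e)
  primed-run-rows ≤′-refl _ n∈ m∈ with once _ _ _ _ _ _ _ n∈ m∈
  ... | refl , refl , _ = ≤-refl , λ _ → refl
  primed-run-rows {c = c} {e = e} (≤′-step n≤′m) nd n∈ m+1∈ with occurs-before n∈ n≤′m m+1∈
  ... | a′ , b′ , false , m∈ = contradiction (descA _ _ _ _ m∈ m+1∈) (NoDescentIn-last n≤′m nd)
  ... | a′ , b′ , true , m∈ with primed-run-rows n≤′m (NoDescentIn-init nd) n∈ m∈
  ...   | a≤a′ , same-row with (a′ ≟ c) ×-dec (b′ ≟ e)
  ...     | yes (refl , refl) = a≤a′ , same-row
  ...     | no other-box = <⇒≤ a<c , λ a≡c → contradiction a≡c (<⇒≢ a<c)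
    where
    a<c = ≤-<-trans a≤a′ (≰⇒> λ c≤a′ →
            NoDescentIn-last n≤′m nd (descC _ _ _ _ m∈ m+1∈ other-box c≤a′))

module Relabel {r : ℕ} {λs : List ℕ} {T : Filling} {s : ℕ → ℕ}
               (SP : IsStrictPartition λs) (ST : IsStandard r λs T) (AG : Agrees r T s) where
  open IsStandard ST
  open IsWeakSetValued (IsSetValued.weak setValued)
  open Agrees AG
  open Runs ST

  ∈-relabel⁻ : ∀ {i j ℓ} → ℓ ∈ relabel s T i j → ∃[ n ] mk n (primed ℓ) ∈ T i j × s n ≡ num ℓ
  ∈-relabel⁻ ℓ∈ with ∈-map⁻ _ ℓ∈
  ... | mk n p , n∈ , refl = n , n∈ , refl

  s-mono : ∀ {n m} → 1 ≤ n → n ≤ m → m ≤ r → s n ≤ s m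
  s-mono 1≤n n≤m m≤r = mono-on weakly 1≤n (≤⇒≤′ n≤m) m≤r

  -- A descent i inside the run would force s i < s (i+1) ≤ s m ≤ s n ≤ s i.
  constant-run : ∀ {n m p q a b c e} → mk n p ∈ T a b → mk m q ∈ T c e →
                 n ≤ m → s m ≤ s n → NoDescentIn n m
  constant-run n∈ m∈ n≤m sm≤sn i n≤i i<m descent =
    <⇒≱ (strict i (≤-trans 1≤n n≤i) i<r descent)
        (≤-trans (s-mono (s≤s z≤n) i<m m≤r) (≤-trans sm≤sn (s-mono 1≤n n≤i (<⇒≤ i<r))))
    where
    1≤n = positive _ _ _ n∈
    m≤r = bounded _ _ _ m∈
    i<r = <-≤-trans i<m m≤r

  relabel-mono : ∀ {n p m q a b c e} → n < m → mk n p ∈ T a b → mk m q ∈ T c e →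
                 mk (s n) p ≼ mk (s m) q
  relabel-mono {n} {p} {m} {q} n<m n∈ m∈
    with m≤n⇒m<n∨m≡n (s-mono (positive _ _ _ n∈) (<⇒≤ n<m) (bounded _ _ _ m∈))
  ... | inj₁ sn<sm = num<⇒≼ {mk (s n) p} {mk (s m) q} sn<sm
  ... | inj₂ sn≡sm = subst (λ w → mk (s n) p ≼ mk w q) sn≡sm (≼-same-num unprimed-stays)
    where
    unprimed-stays : p ≡ false → q ≡ false
    unprimed-stays refl = unprimed-run (≤⇒≤′ (<⇒≤ n<m))
      (constant-run n∈ m∈ (<⇒≤ n<m) (≤-reflexive (sym sn≡sm))) n∈ m∈

  ≼-other-box⇒num< : ∀ {x y a b c e} → x ∈ T a b → y ∈ T c e → x ≼ y →
                     ¬ (a ≡ c × b ≡ e) → num x < num y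
  ≼-other-box⇒num< {mk n p} {mk m q} n∈ m∈ x≼y other-box =
    ≤∧≢⇒< (≼⇒num≤ {mk n p} {mk m q} x≼y) λ { refl →
      let a≡c , b≡e , _ = once _ _ _ _ _ _ _ n∈ m∈ in other-box (a≡c , b≡e) }

  relabel-≼ : ∀ {a b c e} → ¬ (a ≡ c × b ≡ e) → (∀ x y → x ∈ T a b → y ∈ T c e → x ≼ y) →
              ∀ {x y} → x ∈ relabel s T a b → y ∈ relabel s T c e → x ≼ y
  relabel-≼ other-box ≼-in-T x∈ y∈ with ∈-map⁻ _ x∈ | ∈-map⁻ _ y∈
  ... | mk n p , n∈ , refl | mk m q , m∈ , refl =
    relabel-mono (≼-other-box⇒num< n∈ m∈ (≼-in-T _ _ n∈ m∈) other-box) n∈ m∈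

  unprimed-column-unique-≤ : ∀ {n m i i′ j} → n ≤ m → s n ≡ s m →
                             mk n false ∈ T i j → mk m false ∈ T i′ j → i ≡ i′
  unprimed-column-unique-≤ {n} {m} n≤m sn≡sm n∈ m∈
    with m≤n⇒m<n∨m≡n (unprimed-run-rows (≤⇒≤′ n≤m) run n∈ m∈)
    where run = constant-run n∈ m∈ n≤m (≤-reflexive (sym sn≡sm))
  ... | inj₂ i′≡i = sym i′≡i
  ... | inj₁ i′<i with ≤-antisym n≤m (≼⇒num≤ {mk m false} {mk n false} m≼n)
    where m≼n = column-≼ (IsSetValued.weak setValued) SP i′<i m∈ n∈
  ...   | refl = proj₁ (once _ _ _ _ _ _ _ n∈ m∈)

  unprimed-column-unique : ∀ {n m i i′ j} → s n ≡ s m →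
                           mk n false ∈ T i j → mk m false ∈ T i′ j → i ≡ i′
  unprimed-column-unique {n} {m} sn≡sm n∈ m∈ with ≤-total n m
  ... | inj₁ n≤m = unprimed-column-unique-≤ n≤m sn≡sm n∈ m∈
  ... | inj₂ m≤n = sym (unprimed-column-unique-≤ m≤n (sym sn≡sm) m∈ n∈)

  primed-row-unique-≤ : ∀ {n m i j j′} → n ≤ m → s n ≡ s m →
                        mk n true ∈ T i j → mk m true ∈ T i j′ → j ≡ j′
  primed-row-unique-≤ n≤m sn≡sm n∈ m∈ =
    proj₂ (primed-run-rows (≤⇒≤′ n≤m) (constant-run n∈ m∈ n≤m (≤-reflexive (sym sn≡sm))) n∈ m∈) refl

  primed-row-unique : ∀ {n m i j j′} → s n ≡ s m →
                      mk n true ∈ T i j → mk m true ∈ T i j′ → j ≡ j′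
  primed-row-unique {n} {m} sn≡sm n∈ m∈ with ≤-total n m
  ... | inj₁ n≤m = primed-row-unique-≤ n≤m sn≡sm n∈ m∈
  ... | inj₂ m≤n = sym (primed-row-unique-≤ m≤n (sym sn≡sm) m∈ n∈)

  relabel-weak : IsWeakSetValued λs (relabel s T)
  relabel-weak = record
    { outside  = λ i j ∉shape → cong (map _) (outside i j ∉shape)
    ; nonempty = λ i j ∈shape → map-≢[] (nonempty i j ∈shape)
    ; positive = λ i j ℓ ℓ∈ → let n , n∈ , sn≡ℓ = ∈-relabel⁻ ℓ∈ in
                 subst (1 ≤_) sn≡ℓ (posVar n (positive _ _ _ n∈) (bounded _ _ _ n∈))
    ; rowWeak  = λ i j _ _ → relabel-≼ (λ (_ , j≡1+j) → 1+n≢n (sym j≡1+j)) (rowWeak i j)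
    ; colWeak  = λ i j _ _ → relabel-≼ (λ (i≡1+i , _) → 1+n≢n (sym i≡1+i)) (colWeak i j)
    ; diag     = λ i ℓ ℓ∈ → let n , n∈ , _ = ∈-relabel⁻ ℓ∈ in diag i _ n∈
    ; colUnp   = λ k i i′ j k∈ k∈′ →
                 let n , n∈ , sn≡k = ∈-relabel⁻ k∈ ; m , m∈ , sm≡k = ∈-relabel⁻ k∈′ in
                 unprimed-column-unique (trans sn≡k (sym sm≡k)) n∈ m∈
    ; rowPr    = λ k i j j′ k∈ k∈′ →
                 let n , n∈ , sn≡k = ∈-relabel⁻ k∈ ; m , m∈ , sm≡k = ∈-relabel⁻ k∈′ in
                 primed-row-unique (trans sn≡k (sym sm≡k)) n∈ m∈
    }

lemma3p8 : (r : ℕ) (λs : List ℕ) → IsStrictPartition λs →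
           (T : Filling) → IsStandard r λs T →
           (s : ℕ → ℕ) → Agrees r T s →
           IsWeakSetValued λs (relabel s T)
lemma3p8 r λs SP T ST s AG = Relabel.relabel-weak SP ST AG
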